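{- If $G$ is a bipartite graph, then $G$ is not $q$-weakly Cockayne–Lorimer for any integer $q\ge 1$.
   Context: $\nu(G)$ is the matching number. For $\mathbf{t}=(t_1,\dots,t_q)\in\mathbb{N}_+^q$ (positive integers), $\Lambda_\mathbf{t}=\sum_{i=1}^q(t_i-1)$, and $G\to\mathbf{t}K_2$ means every colouring of the edges of $G$ with colours $1,\dots,q$ contains, for some $j$, a matching of size $t_j$ all of whose edges have colour $j$. $G$ is $q$-weakly Cockayne–Lorimer if there exists $\mathbf{t}\in\mathbb{N}_+^q$ with $\Lambda_\mathbf{t}\ge\nu(G)$ such that $G\to\mathbf{t}K_2$. -}

module Defs where

open import Data.Nat using (ℕ; _≤_; _∸_)
open import Data.Fin using (Fin)
open import Data.Bool using (Bool; true; false)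
open import Data.Product using (_×_; _,_; proj₁; proj₂; Σ; ∃; ∃-syntax)
open import Data.Sum using (_⊎_; inj₁; inj₂)
open import Data.List using (tabulate)
open import Data.Nat.ListAction using (sum)
open import Relation.Binary.PropositionalEquality using (_≡_; _≢_)
open import Function.Definitions using (Injective)

record Graph (n : ℕ) : Set where
  field
    adj    : Fin n → Fin n → Bool
    sym    : ∀ u v → adj u v ≡ adj v u
    irrefl : ∀ u → adj u u ≡ false
open Graph public

Bipartite : ∀ {n} → Graph n → Set
Bipartite {n} G = Σ (Fin n → Bool) λ side →
  ∀ u v → adj G u v ≡ true → side u ≢ side v

endpoints : ∀ {n k} → (Fin k → Fin n × Fin n) → Fin k ⊎ Fin k → Fin n
endpoints e (inj₁ i) = proj₁ (e i)
endpoints e (inj₂ i) = proj₂ (e i)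

record Matching {n : ℕ} (G : Graph n) (k : ℕ) : Set where
  field
    edge     : Fin k → Fin n × Fin n
    adjacent : ∀ i → adj G (proj₁ (edge i)) (proj₂ (edge i)) ≡ true
    disjoint : Injective _≡_ _≡_ (endpoints edge)
open Matching public

IsMatchingNumber : ∀ {n} → Graph n → ℕ → Set
IsMatchingNumber G m = Matching G m × (∀ k → Matching G k → k ≤ m)

-- An edge colouring with colours Fin q (a symmetric function on vertex pairs;
-- only its values on edges matter).
record Colouring {n : ℕ} (G : Graph n) (q : ℕ) : Set where
  field
    colour : Fin n → Fin n → Fin q
    colour-sym : ∀ u v → colour u v ≡ colour v u
open Colouring public

MonoMatching : ∀ {n q} (G : Graph n) → Colouring G q → Fin q → ℕ → Set
MonoMatching G c j k = Σ (Matching G k) λ M →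
  ∀ i → colour c (proj₁ (edge M i)) (proj₂ (edge M i)) ≡ j

Λ : ∀ {q} → (Fin q → ℕ) → ℕ
Λ {q} t = sum (tabulate {n = q} (λ i → t i ∸ 1))

Arrows : ∀ {n q} → Graph n → (Fin q → ℕ) → Set
Arrows {n} {q} G t = (c : Colouring G q) → ∃[ j ] MonoMatching G c j (t j)

WeaklyCL : ∀ {n} → ℕ → Graph n → Set
WeaklyCL {n} q G = Σ (Fin q → ℕ) λ t →
  (∀ i → 1 ≤ t i) × (∃[ ν ] (IsMatchingNumber G ν × ν ≤ Λ t)) × Arrows G t

module Submission where

-- A bipartite graph has a vertex cover C and a matching of the same size (König), so
-- ∣C∣ ≤ ν(G) ≤ Λ_t. Split C into groups, group j having at most tⱼ − 1 vertices, and give every edge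
-- the colour of the group of a cover vertex on it. The edges of a matching of colour j are covered
-- by pairwise distinct vertices of group j, so there are at most tⱼ − 1 of them, and G ↛ t K₂.
--
-- König's theorem is proved by well-founded induction following Rizzi. For an edge uv take a
-- matching M and a cover C of G − v of equal size. If M misses u, then M + uv and C + v do. Otherwise
-- let w be the partner of u. If u has a third neighbour x, the pair for G − ux either works for G or
-- its cover contains u, since it cannot contain the M-exposed vertex v. If v and w are the only
-- neighbours of u, contract the path v u w to v and lift the pair of the contraction.

open import Defs hiding (sym)
open import Data.Bool using (Bool; true; if_then_else_)
import Data.Bool.Properties as Bool
open import Data.Fin using (Fin; zero; suc; toℕ; inject≤; splitAt; join; punchOut; fromℕ<)
open import Data.Fin.Permutation.Components using (transpose; transpose-inverse)
open import Data.Fin.Properties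
  using (_≟_; any?; injective⇒≤; punchOut-injective; inject≤-injective; join-splitAt; toℕ-injective;
         toℕ<n; toℕ-fromℕ<; suc-injective)
open import Data.List using (List; []; _∷_; filter; allFin)
open import Data.List.Membership.Propositional using (_∈_)
open import Data.List.Membership.Propositional.Properties using (∈-filter⁺; ∈-filter⁻; ∈-allFin)
open import Data.List.Properties using (filter-≐)
open import Data.List.Relation.Unary.Any using (here)
open import Data.Nat using (ℕ; zero; suc; _∸_; _≤_; _<_; _<?_; z≤n; s≤s; z<s)
open import Data.Nat.Induction using (<-wellFounded)
open import Data.Nat.Properties
  using (+-0-monoid; ≤-refl; ≤-trans; <-≤-trans; <⇒≱; ≮⇒≥; +-mono-≤; +-mono-<-≤; +-mono-≤-<; ∸-monoʳ-<)
open import Algebra.Properties.Monoid.Sum +-0-monoid using (sum)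
open import Data.Product using (_×_; _,_; proj₁; proj₂; ∃; map₁; map₂)
open import Data.Product.Relation.Binary.Lex.Strict using (×-Lex; ×-wellFounded')
open import Data.Sum as Sum using (_⊎_; inj₁; inj₂; [_,_]′; reduce; swap)
import Data.Vec.Functional as Vector
open import Function using (_∘_; _on_; case_of_; mk⇔)
open import Function.Definitions using (Injective)
open import Induction.WellFounded using (WellFounded; Acc; acc)
open import Relation.Binary.Construct.On as On using ()
open import Relation.Binary.PropositionalEquality
  using (_≡_; _≢_; refl; sym; trans; cong; cong₂; subst; subst₂)
open import Relation.Nullary using (¬_; Dec; yes; no; does; contradiction)
open import Relation.Nullary.Decidable using (_×-dec_; _⊎-dec_; ¬?; dec-true; dec-false; does-⇔)

variable
  n k m : ℕ
  a b u v w x y : Fin n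

-- Graphs and the operations of the induction

Adj : Graph n → Fin n → Fin n → Set
Adj G a b = adj G a b ≡ true

adj? : (G : Graph n) → ∀ a b → Dec (Adj G a b)
adj? G a b = adj G a b Bool.≟ true

module _ (G : Graph n) where

  Adj-sym : Adj G a b → Adj G b a
  Adj-sym {a} {b} ab = trans (Graph.sym G b a) ab

  Adj-irrefl : Adj G a b → a ≢ b
  Adj-irrefl {a} ab refl = case trans (sym ab) (irrefl G a) of λ ()

_⊆_ : Graph n → Graph n → Set
H ⊆ G = ∀ {a b} → Adj H a b → Adj G a b

module _ {E : Fin n → Fin n → Set} (E? : ∀ a b → Dec (E a b))
         (E-sym : ∀ {a b} → E a b → E b a) (E-irrefl : ∀ {a} → ¬ E a a) where

  -- Opaque, so that adjacency in the graphs built from it does not unfold into boolean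
  -- decisions, which would hide the endpoints from unification and from with-abstraction.
  opaque
    graphOf : Graph n
    graphOf = record
      { adj    = λ a b → does (E? a b)
      ; sym    = λ a b → does-⇔ (mk⇔ E-sym E-sym) (E? a b) (E? b a)
      ; irrefl = λ a → dec-false (E? a a) E-irrefl
      }

    graphOf⁺ : E a b → Adj graphOf a b
    graphOf⁺ = dec-true (E? _ _)

    graphOf⁻ : Adj graphOf a b → E a b
    graphOf⁻ {a} {b} ab with E? a b | ab
    ... | yes e | _ = e
    ... | no _ | ()

Incident : Fin n → Fin n → Fin n → Set
Incident x a b = x ≡ a ⊎ x ≡ b

Joins : Fin n → Fin n → Fin n → Fin n → Set
Joins x y a b = (a ≡ x × b ≡ y) ⊎ (a ≡ y × b ≡ x)

joins? : (x y a b : Fin n) → Dec (Joins x y a b)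
joins? x y a b = (a ≟ x ×-dec b ≟ y) ⊎-dec (a ≟ y ×-dec b ≟ x)

Joins-sym : Joins x y a b → Joins x y b a
Joins-sym (inj₁ (a≡x , b≡y)) = inj₂ (b≡y , a≡x)
Joins-sym (inj₂ (a≡y , b≡x)) = inj₁ (b≡x , a≡y)

Joins⇒Incidentˡ : Joins x y a b → Incident x a b
Joins⇒Incidentˡ (inj₁ (a≡x , _)) = inj₁ (sym a≡x)
Joins⇒Incidentˡ (inj₂ (_ , b≡x)) = inj₂ (sym b≡x)

Joins⇒Incidentʳ : Joins x y a b → Incident y a b
Joins⇒Incidentʳ (inj₁ (_ , b≡y)) = inj₂ (sym b≡y)
Joins⇒Incidentʳ (inj₂ (a≡y , _)) = inj₁ (sym a≡y)

module _ (G : Graph n) (v : Fin n) where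

  private
    Avoiding : Fin n → Fin n → Set
    Avoiding a b = Adj G a b × a ≢ v × b ≢ v

    avoiding? : ∀ a b → Dec (Avoiding a b)
    avoiding? a b = adj? G a b ×-dec ¬? (a ≟ v) ×-dec ¬? (b ≟ v)

    Avoiding-sym : Avoiding a b → Avoiding b a
    Avoiding-sym (ab , a≢v , b≢v) = Adj-sym G ab , b≢v , a≢v

    Avoiding-irrefl : ¬ Avoiding a a
    Avoiding-irrefl (aa , _) = Adj-irrefl G aa refl

  deleteVertex : Graph n
  deleteVertex = graphOf avoiding? Avoiding-sym Avoiding-irrefl

  deleteVertex⁻ : Adj deleteVertex a b → Adj G a b × a ≢ v × b ≢ v
  deleteVertex⁻ = graphOf⁻ avoiding? Avoiding-sym Avoiding-irrefl

  deleteVertex⁺ : Adj G a b → a ≢ v → b ≢ v → Adj deleteVertex a b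
  deleteVertex⁺ ab a≢v b≢v = graphOf⁺ avoiding? Avoiding-sym Avoiding-irrefl (ab , a≢v , b≢v)

  deleteVertex-⊆ : deleteVertex ⊆ G
  deleteVertex-⊆ {a} {b} = proj₁ ∘ deleteVertex⁻ {a} {b}

  deleteVertex-∌ : ¬ Adj deleteVertex a v
  deleteVertex-∌ av = proj₂ (proj₂ (deleteVertex⁻ av)) refl

module _ (G : Graph n) (x y : Fin n) where

  private
    Other : Fin n → Fin n → Set
    Other a b = Adj G a b × ¬ Joins x y a b

    other? : ∀ a b → Dec (Other a b)
    other? a b = adj? G a b ×-dec ¬? (joins? x y a b)

    Other-sym : Other a b → Other b a
    Other-sym (ab , ¬j) = Adj-sym G ab , ¬j ∘ Joins-sym

    Other-irrefl : ¬ Other a a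
    Other-irrefl (aa , _) = Adj-irrefl G aa refl

  deleteEdge : Graph n
  deleteEdge = graphOf other? Other-sym Other-irrefl

  deleteEdge-⊆ : deleteEdge ⊆ G
  deleteEdge-⊆ = proj₁ ∘ graphOf⁻ other? Other-sym Other-irrefl

  deleteEdge⁺ : Adj G a b → ¬ Joins x y a b → Adj deleteEdge a b
  deleteEdge⁺ ab ¬j = graphOf⁺ other? Other-sym Other-irrefl (ab , ¬j)

  deleteEdge-∌ : ¬ Adj deleteEdge x y
  deleteEdge-∌ xy = proj₂ (graphOf⁻ other? Other-sym Other-irrefl xy) (inj₁ (refl , refl))

module _ (G : Graph n) (u v w : Fin n) where

  Kept : Fin n → Set
  Kept x = x ≢ u × x ≢ w

  Merged : Fin n → Fin n → Set
  Merged a b = Kept a × Kept b × (Adj G a b ⊎ (a ≡ v × Adj G w b) ⊎ (b ≡ v × Adj G a w))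

  private
    kept? : ∀ x → Dec (Kept x)
    kept? x = ¬? (x ≟ u) ×-dec ¬? (x ≟ w)

    merged? : ∀ a b → Dec (Merged a b)
    merged? a b = kept? a ×-dec kept? b ×-dec
      (adj? G a b ⊎-dec (a ≟ v ×-dec adj? G w b) ⊎-dec (b ≟ v ×-dec adj? G a w))

    Merged-sym : Merged a b → Merged b a
    Merged-sym (ka , kb , inj₁ ab)                = kb , ka , inj₁ (Adj-sym G ab)
    Merged-sym (ka , kb , inj₂ (inj₁ (a≡v , wb))) = kb , ka , inj₂ (inj₂ (a≡v , Adj-sym G wb))
    Merged-sym (ka , kb , inj₂ (inj₂ (b≡v , aw))) = kb , ka , inj₂ (inj₁ (b≡v , Adj-sym G aw))

  module _ (v≁w : ¬ Adj G v w) where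

    private
      Merged-irrefl : ¬ Merged a a
      Merged-irrefl (_ , _ , inj₁ aa)                 = Adj-irrefl G aa refl
      Merged-irrefl (_ , _ , inj₂ (inj₁ (refl , wv))) = v≁w (Adj-sym G wv)
      Merged-irrefl (_ , _ , inj₂ (inj₂ (refl , vw))) = v≁w vw

    -- u is isolated and w is identified with v; if v and w are the only neighbours of u, this
    -- contracts the path v u w to v.
    merge : Graph n
    merge = graphOf merged? Merged-sym Merged-irrefl

    merge⁻ : Adj merge a b → Merged a b
    merge⁻ = graphOf⁻ merged? Merged-sym Merged-irrefl

    merge⁺ : Merged a b → Adj merge a b
    merge⁺ = graphOf⁺ merged? Merged-sym Merged-irrefl

IsBipartition : (Fin n → Bool) → Graph n → Set
IsBipartition side G = ∀ {a b} → Adj G a b → side a ≢ side b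

module _ {side : Fin n → Bool} where

  ⊆-isBipartition : {H G : Graph n} → H ⊆ G → IsBipartition side G → IsBipartition side H
  ⊆-isBipartition H⊆G bip = bip ∘ H⊆G

  merge-isBipartition : {G : Graph n} (v≁w : ¬ Adj G v w) → side v ≡ side w →
                        IsBipartition side G → IsBipartition side (merge G u v w v≁w)
  merge-isBipartition {v = v} {w} {u} {G} v≁w v∼w bip ab with merge⁻ G u v w v≁w ab
  ... | _ , _ , inj₁ ab′               = bip ab′
  ... | _ , _ , inj₂ (inj₁ (refl , wb)) = bip wb ∘ trans (sym v∼w)
  ... | _ , _ , inj₂ (inj₂ (refl , aw)) = λ a∼v → bip aw (trans a∼v v∼w)

-- A well-founded order on graphs

count : {P : Fin n → Set} → (∀ a → Dec (P a)) → ℕ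
count P? = sum λ a → if does (P? a) then 1 else 0

sum-mono-≤ : {f g : Fin n → ℕ} → (∀ i → f i ≤ g i) → sum f ≤ sum g
sum-mono-≤ {zero}  f≤g = z≤n
sum-mono-≤ {suc n} f≤g = +-mono-≤ (f≤g zero) (sum-mono-≤ (f≤g ∘ suc))

sum-mono-< : {f g : Fin n → ℕ} → (∀ i → f i ≤ g i) → ∀ i → f i < g i → sum f < sum g
sum-mono-< f≤g zero    fi<gi = +-mono-<-≤ fi<gi (sum-mono-≤ (f≤g ∘ suc))
sum-mono-< f≤g (suc i) fi<gi = +-mono-≤-< (f≤g zero) (sum-mono-< (f≤g ∘ suc) i fi<gi)

module _ {P Q : Fin n → Set} (P? : ∀ a → Dec (P a)) (Q? : ∀ a → Dec (Q a))
         (P⊆Q : ∀ {a} → P a → Q a) where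

  indicator-mono-≤ : ∀ a → (if does (P? a) then 1 else 0) ≤ (if does (Q? a) then 1 else 0)
  indicator-mono-≤ a with P? a | Q? a
  ... | no _  | _      = z≤n
  ... | yes _ | yes _  = ≤-refl
  ... | yes p | no ¬q  = contradiction (P⊆Q p) ¬q

  count-mono-≤ : count P? ≤ count Q?
  count-mono-≤ = sum-mono-≤ indicator-mono-≤

  count-mono-< : ∀ a → ¬ P a → Q a → count P? < count Q?
  count-mono-< a ¬p q = sum-mono-< indicator-mono-≤ a
    (subst₂ _<_ (cong (λ d → if d then 1 else 0) (sym (dec-false (P? a) ¬p)))
                (cong (λ d → if d then 1 else 0) (sym (dec-true (Q? a) q))) z<s)

degree : Graph n → Fin n → ℕ
degree G a = count (adj? G a)

nonIsolated : Graph n → ℕ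
nonIsolated G = count λ a → any? (adj? G a)

measure : Graph n → ℕ × ℕ
measure G = nonIsolated G , sum (degree G)

-- Contractions lower the number of non-isolated vertices, edge deletions the degree sum.
_≺_ : Graph n → Graph n → Set
_≺_ = ×-Lex _≤_ _<_ _<_ on measure

≺-wellFounded : WellFounded (_≺_ {n})
≺-wellFounded = On.wellFounded measure
  (×-wellFounded' ≤-trans (λ y≤z x<y → <-≤-trans x<y y≤z) <-wellFounded <-wellFounded)

⊂-≺ : {H G : Graph n} → H ⊆ G → ¬ Adj H a b → Adj G a b → H ≺ G
⊂-≺ {a = a} {b} {H} {G} H⊆G a≁b ab = inj₂
  ( count-mono-≤ (λ x → any? (adj? H x)) (λ x → any? (adj? G x)) (map₂ H⊆G)
  , sum-mono-< (λ x → count-mono-≤ (adj? H x) (adj? G x) H⊆G) a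
      (count-mono-< (adj? H a) (adj? G a) H⊆G b a≁b ab) )

merge-≺ : {G : Graph n} (v≁w : ¬ Adj G v w) → Adj G u v → merge G u v w v≁w ≺ G
merge-≺ {n} {v} {w} {u} {G} v≁w uv = inj₁
  (count-mono-< (λ x → any? (adj? G′ x)) (λ x → any? (adj? G x)) neighbourInG u
     (λ (_ , ub) → proj₁ (proj₁ (merge⁻ G u v w v≁w ub)) refl) (v , uv))
  where
  G′ : Graph n
  G′ = merge G u v w v≁w

  neighbourInG : ∃ (Adj G′ a) → ∃ (Adj G a)
  neighbourInG (b , ab) with merge⁻ G u v w v≁w ab
  ... | _ , _ , inj₁ ab′              = b , ab′
  ... | _ , _ , inj₂ (inj₁ (refl , _)) = u , Adj-sym G uv
  ... | _ , _ , inj₂ (inj₂ (_ , aw))   = w , aw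

-- Matchings and vertex covers

end : {G : Graph n} → Matching G k → Fin k ⊎ Fin k → Fin n
end M = endpoints (edge M)

Saturates : {G : Graph n} → Matching G k → Fin n → Set
Saturates M x = ∃ λ s → end M s ≡ x

Exposed : {G : Graph n} → Matching G k → Fin n → Set
Exposed M x = ¬ Saturates M x

module _ {G : Graph n} (M : Matching G k) where

  saturates? : ∀ x → Dec (Saturates M x)
  saturates? x with any? (λ i → (proj₁ (edge M i) ≟ x) ⊎-dec (proj₂ (edge M i) ≟ x))
  ... | yes (i , inj₁ p) = yes (inj₁ i , p)
  ... | yes (i , inj₂ p) = yes (inj₂ i , p)
  ... | no ¬∃ = no λ { (inj₁ i , p) → ¬∃ (i , inj₁ p) ; (inj₂ i , p) → ¬∃ (i , inj₂ p) }

  end-swap-adjacent : ∀ s → Adj G (end M s) (end M (swap s))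
  end-swap-adjacent (inj₁ i) = adjacent M i
  end-swap-adjacent (inj₂ i) = Adj-sym G (adjacent M i)

  partner-unique : ∀ s s′ → end M s ≡ x → end M s′ ≡ x → end M (swap s) ≡ end M (swap s′)
  partner-unique s s′ p q = cong (end M ∘ swap) (disjoint M {s} {s′} (trans p (sym q)))

retarget : {H G : Graph n} (M : Matching H k) →
           (∀ i → Adj G (proj₁ (edge M i)) (proj₂ (edge M i))) → Matching G k
retarget M adjacent′ = record { edge = edge M ; adjacent = adjacent′ ; disjoint = disjoint M }

⊆-matching : {H G : Graph n} → H ⊆ G → Matching H k → Matching G k
⊆-matching {G = G} H⊆G M = retarget {G = G} M (H⊆G ∘ adjacent M)

relabel : {H G : Graph n} (M : Matching H k) {f : Fin n → Fin n} → Injective _≡_ _≡_ f →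
          (∀ i → Adj G (f (proj₁ (edge M i))) (f (proj₂ (edge M i)))) → Matching G k
relabel M {f} f-injective adjacent′ = record
  { edge     = e′
  ; adjacent = adjacent′
  ; disjoint = λ {s} {s′} p → disjoint M (f-injective′ {s} {s′} p) }
  where
  e′ : Fin _ → Fin _ × Fin _
  e′ i = f (proj₁ (edge M i)) , f (proj₂ (edge M i))

  f-injective′ : ∀ {s s′} → endpoints e′ s ≡ endpoints e′ s′ → end M s ≡ end M s′
  f-injective′ {inj₁ _} {inj₁ _} = f-injective
  f-injective′ {inj₁ _} {inj₂ _} = f-injective
  f-injective′ {inj₂ _} {inj₁ _} = f-injective
  f-injective′ {inj₂ _} {inj₂ _} = f-injective

relabel-exposed : {H G : Graph n} (M : Matching H k) {f : Fin n → Fin n}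
                  (f-inj : Injective _≡_ _≡_ f) →
                  (adjacent′ : ∀ i → Adj G (f (proj₁ (edge M i))) (f (proj₂ (edge M i)))) →
                  Exposed M x → Exposed (relabel {G = G} M f-inj adjacent′) (f x)
relabel-exposed M f-inj _ x∉M (inj₁ i , p) = x∉M (inj₁ i , f-inj p)
relabel-exposed M f-inj _ x∉M (inj₂ i , p) = x∉M (inj₂ i , f-inj p)

extend : {G : Graph n} (M : Matching G k) → Adj G x y → Exposed M x → Exposed M y → Matching G (suc k)
extend {n} {k} {x} {y} {G} M xy x∉M y∉M = record
  { edge = (x , y) Vector.∷ edge M ; adjacent = adjacent′ ; disjoint = disjoint′ }
  where
  adjacent′ : ∀ i → Adj G (proj₁ (((x , y) Vector.∷ edge M) i))
                          (proj₂ (((x , y) Vector.∷ edge M) i))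
  adjacent′ zero    = xy
  adjacent′ (suc i) = adjacent M i

  old : Fin k ⊎ Fin k → Fin (suc k) ⊎ Fin (suc k)
  old = Sum.map suc suc

  disjoint′ : Injective _≡_ _≡_ (endpoints ((x , y) Vector.∷ edge M))
  disjoint′ {inj₁ zero}    {inj₁ zero}    _ = refl
  disjoint′ {inj₂ zero}    {inj₂ zero}    _ = refl
  disjoint′ {inj₁ zero}    {inj₂ zero}    p = contradiction p (Adj-irrefl G xy)
  disjoint′ {inj₂ zero}    {inj₁ zero}    p = contradiction (sym p) (Adj-irrefl G xy)
  disjoint′ {inj₁ zero}    {inj₁ (suc j)} p = contradiction (inj₁ j , sym p) x∉M
  disjoint′ {inj₁ zero}    {inj₂ (suc j)} p = contradiction (inj₂ j , sym p) x∉M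
  disjoint′ {inj₂ zero}    {inj₁ (suc j)} p = contradiction (inj₁ j , sym p) y∉M
  disjoint′ {inj₂ zero}    {inj₂ (suc j)} p = contradiction (inj₂ j , sym p) y∉M
  disjoint′ {inj₁ (suc i)} {inj₁ zero}    p = contradiction (inj₁ i , p) x∉M
  disjoint′ {inj₂ (suc i)} {inj₁ zero}    p = contradiction (inj₂ i , p) x∉M
  disjoint′ {inj₁ (suc i)} {inj₂ zero}    p = contradiction (inj₁ i , p) y∉M
  disjoint′ {inj₂ (suc i)} {inj₂ zero}    p = contradiction (inj₂ i , p) y∉M
  disjoint′ {inj₁ (suc i)} {inj₁ (suc j)} p = cong old (disjoint M {inj₁ i} {inj₁ j} p)
  disjoint′ {inj₁ (suc i)} {inj₂ (suc j)} p = cong old (disjoint M {inj₁ i} {inj₂ j} p)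
  disjoint′ {inj₂ (suc i)} {inj₁ (suc j)} p = cong old (disjoint M {inj₂ i} {inj₁ j} p)
  disjoint′ {inj₂ (suc i)} {inj₂ (suc j)} p = cong old (disjoint M {inj₂ i} {inj₂ j} p)

CoveredBy : (Fin m → Fin n) → Fin n → Fin n → Set
CoveredBy c a b = ∃ λ κ → Incident (c κ) a b

record Cover (G : Graph n) (m : ℕ) : Set where
  field
    vertex : Fin m → Fin n
    covers : ∀ {a b} → Adj G a b → CoveredBy vertex a b
open Cover

extendCover : {G : Graph n} (c : Fin m → Fin n) →
              (∀ {a b} → Adj G a b → Incident x a b ⊎ CoveredBy c a b) → Cover G (suc m)
extendCover {x = x} c h = record
  { vertex = x Vector.∷ c
  ; covers = [ (zero ,_) , (λ (κ , p) → suc κ , p) ]′ ∘ h }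

module _ {G : Graph n} (M : Matching G k) {c : Fin m → Fin n} where

  coveringEnd : ∀ i → (h : CoveredBy c (proj₁ (edge M i)) (proj₂ (edge M i))) →
                ∃ λ s → reduce s ≡ i × end M s ≡ c (proj₁ h)
  coveringEnd i (_ , inj₁ p) = inj₁ i , refl , sym p
  coveringEnd i (_ , inj₂ p) = inj₂ i , refl , sym p

  coverChoice-injective : (h : ∀ i → CoveredBy c (proj₁ (edge M i)) (proj₂ (edge M i))) →
                          Injective _≡_ _≡_ (proj₁ ∘ h)
  coverChoice-injective h {i} {j} κᵢ≡κⱼ
    with s , refl , p ← coveringEnd i (h i) | s′ , refl , q ← coveringEnd j (h j) =
    cong reduce (disjoint M {s} {s′} (trans p (trans (cong c κᵢ≡κⱼ) (sym q))))

injective-avoiding⇒< : {f : Fin k → Fin m} → Injective _≡_ _≡_ f → (κ : Fin m) → (∀ i → f i ≢ κ) →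
                       k < m
injective-avoiding⇒< {m = suc _} {f} f-inj κ avoids =
  s≤s (injective⇒≤ {f = λ i → punchOut (avoids i ∘ sym)} λ {i} {j} p →
    f-inj (punchOut-injective (avoids i ∘ sym) (avoids j ∘ sym) p))

-- A cover no larger than a matching spends one vertex on each matching edge, so it misses every
-- exposed vertex.
exposed∉cover : {G : Graph n} (M : Matching G k) (C : Cover G m) → m ≤ k → Exposed M x →
                ∀ κ → vertex C κ ≢ x
exposed∉cover M C m≤k x∉M κ refl =
  <⇒≱ (injective-avoiding⇒< (coverChoice-injective M h) κ misses) m≤k
  where
  h : ∀ i → CoveredBy (vertex C) (proj₁ (edge M i)) (proj₂ (edge M i))
  h i = covers C (adjacent M i)

  misses : ∀ i → proj₁ (h i) ≢ κ
  misses i refl with s , _ , p ← coveringEnd M i (h i) = x∉M (s , p)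

-- König's theorem

-- By weak duality the two sizes are then equal, but only the inequality is ever needed.
record KönigPair (G : Graph n) : Set where
  constructor pair
  field
    {matchingSize coverSize} : ℕ
    matching : Matching G matchingSize
    cover    : Cover G coverSize
    cover≤matching : coverSize ≤ matchingSize

deleteVertex-exposed : {G : Graph n} (M : Matching (deleteVertex G v) k) → Exposed M v
deleteVertex-exposed {v = v} {G = G} M (s , s↦v) = avoids s s↦v
  where
  avoids : ∀ s → end M s ≢ v
  avoids (inj₁ i) = proj₁ (proj₂ (deleteVertex⁻ G v (adjacent M i)))
  avoids (inj₂ i) = proj₂ (proj₂ (deleteVertex⁻ G v (adjacent M i)))

deleteVertex-cover : {G : Graph n} → Cover (deleteVertex G v) m → Cover G (suc m)
deleteVertex-cover {v = v} {G = G} C = extendCover (vertex C) covers′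
  where
  covers′ : Adj G a b → Incident v a b ⊎ CoveredBy (vertex C) a b
  covers′ {a} {b} ab with a ≟ v | b ≟ v
  ... | yes a≡v | _       = inj₁ (inj₁ (sym a≡v))
  ... | no _    | yes b≡v = inj₁ (inj₂ (sym b≡v))
  ... | no a≢v  | no b≢v  = inj₂ (covers C (deleteVertex⁺ G v ab a≢v b≢v))

deleteEdge-cover : {G : Graph n} (C : Cover (deleteEdge G x y) m) → ∀ κ → vertex C κ ≡ x →
                   Cover G m
deleteEdge-cover {x = x} {y} {G = G} C κ κ↦x = record { vertex = vertex C ; covers = covers′ }
  where
  covers′ : Adj G a b → CoveredBy (vertex C) a b
  covers′ {a} {b} ab with joins? x y a b
  ... | yes xy = κ , subst (λ z → Incident z a b) (sym κ↦x) (Joins⇒Incidentˡ xy)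
  ... | no ¬xy = covers C (deleteEdge⁺ G x y ab ¬xy)

-- Rizzi's argument: M shows that deleting the edge ux keeps the matching number at least k, and a
-- cover of the smaller graph of size at most k misses the M-exposed vertex v, so it contains u and
-- also covers ux.
rizzi : {G : Graph n} → Adj G u v → v ≢ x → (M : Matching (deleteEdge G u x) k) → Exposed M v →
        Cover G m → m ≤ suc k → KönigPair (deleteEdge G u x) → KönigPair G
rizzi {u = u} {v} {x} {k = k} {G = G} uv v≢x M v∉M C m≤1+k (pair {k′} {m′} M′ C′ m′≤k′)
  with k <? m′
... | yes k<m′ =
  pair (⊆-matching (deleteEdge-⊆ G u x) M′) C (≤-trans m≤1+k (≤-trans k<m′ m′≤k′))
... | no k≮m′ =
  pair (⊆-matching (deleteEdge-⊆ G u x) M) (deleteEdge-cover C′ κ κ↦u) (≮⇒≥ k≮m′)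
  where
  uv′ : Adj (deleteEdge G u x) u v
  uv′ = deleteEdge⁺ G u x uv λ where
    (inj₁ (_ , v≡x))   → v≢x v≡x
    (inj₂ (u≡x , v≡u)) → Adj-irrefl G uv (sym v≡u)

  κ : Fin m′
  κ = proj₁ (covers C′ uv′)

  κ↦u : vertex C′ κ ≡ u
  κ↦u with covers C′ uv′
  ... | _ , inj₁ κ↦u = κ↦u
  ... | κ , inj₂ κ↦v = contradiction κ↦v (exposed∉cover M C′ (≮⇒≥ k≮m′) v∉M κ)

module _ {i j : Fin n} where

  transpose-injective : Injective _≡_ _≡_ (transpose i j)
  transpose-injective {x} {y} p =
    trans (sym (transpose-inverse j i)) (trans (cong (transpose j i) p) (transpose-inverse j i))

  transpose-ˡ : transpose i j i ≡ j
  transpose-ˡ rewrite dec-true (i ≟ i) refl = refl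

  transpose-ʳ : j ≢ i → transpose i j j ≡ i
  transpose-ʳ j≢i rewrite dec-false (j ≟ i) j≢i | dec-true (j ≟ j) refl = refl

  transpose-fix : x ≢ i → x ≢ j → transpose i j x ≡ x
  transpose-fix {x} x≢i x≢j rewrite dec-false (x ≟ i) x≢i | dec-false (x ≟ j) x≢j = refl

module Contraction (G : Graph n) {u v w : Fin n} (uv : Adj G u v) (uw : Adj G u w) (v≢w : v ≢ w)
                   (v≁w : ¬ Adj G v w) (N[u] : ∀ {x} → Adj G u x → x ≡ v ⊎ x ≡ w) where

  private
    G′ : Graph n
    G′ = merge G u v w v≁w

    v-kept : Kept G u v w v
    v-kept = Adj-irrefl G uv ∘ sym , v≢w

    τ : Fin n → Fin n
    τ = transpose v w

  classify : Adj G a b → (Joins u v a b ⊎ Joins u w a b) ⊎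
                         (∃ λ y → Joins w y a b × Merged G u v w v y) ⊎ Merged G u v w a b
  classify {a} {b} ab with a ≟ u | b ≟ u | a ≟ w | b ≟ w
  ... | yes refl | _ | _ | _ =
    inj₁ (Sum.map (λ b≡v → inj₁ (refl , b≡v)) (λ b≡w → inj₁ (refl , b≡w)) (N[u] ab))
  ... | no _ | yes refl | _ | _ =
    inj₁ (Sum.map (λ a≡v → inj₂ (a≡v , refl)) (λ a≡w → inj₂ (a≡w , refl))
                  (N[u] (Adj-sym G ab)))
  ... | no _ | no b≢u | yes refl | _ =
    inj₂ (inj₁ (b , inj₁ (refl , refl) ,
      (v-kept , (b≢u , Adj-irrefl G ab ∘ sym) , inj₂ (inj₁ (refl , ab)))))
  ... | no a≢u | no _ | no a≢w | yes refl =
    inj₂ (inj₁ (a , inj₂ (refl , refl) ,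
      (v-kept , (a≢u , a≢w) , inj₂ (inj₁ (refl , Adj-sym G ab)))))
  ... | no a≢u | no b≢u | no a≢w | no b≢w =
    inj₂ (inj₂ ((a≢u , a≢w) , (b≢u , b≢w) , inj₁ ab))

  liftCover : Cover G′ m → Cover G (suc m)
  liftCover C′ with any? (λ κ → vertex C′ κ ≟ v)
  ... | yes (κ , κ↦v) = extendCover (vertex C′) withW
    where
    withW : Adj G a b → Incident w a b ⊎ CoveredBy (vertex C′) a b
    withW ab with classify ab
    ... | inj₁ (inj₁ uv-edge) =
      inj₂ (κ , subst (λ z → Incident z _ _) (sym κ↦v) (Joins⇒Incidentʳ uv-edge))
    ... | inj₁ (inj₂ uw-edge)           = inj₁ (Joins⇒Incidentʳ uw-edge)
    ... | inj₂ (inj₁ (_ , wy-edge , _)) = inj₁ (Joins⇒Incidentˡ wy-edge)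
    ... | inj₂ (inj₂ ab′)               = inj₂ (covers C′ (merge⁺ G u v w v≁w ab′))
  ... | no v∉C′ = extendCover (vertex C′) withU
    where
    withU : Adj G a b → Incident u a b ⊎ CoveredBy (vertex C′) a b
    withU ab with classify ab
    ... | inj₁ (inj₁ uv-edge) = inj₁ (Joins⇒Incidentˡ uv-edge)
    ... | inj₁ (inj₂ uw-edge) = inj₁ (Joins⇒Incidentˡ uw-edge)
    ... | inj₂ (inj₂ ab′)     = inj₂ (covers C′ (merge⁺ G u v w v≁w ab′))
    ... | inj₂ (inj₁ (y , wy-edge , vy′)) with covers C′ (merge⁺ G u v w v≁w vy′)
    ...   | κ , inj₁ κ↦v = contradiction (κ , κ↦v) v∉C′
    ...   | κ , inj₂ κ↦y =
      inj₂ (κ , subst (λ z → Incident z _ _) (sym κ↦y) (Joins⇒Incidentʳ wy-edge))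

  merged-edge : Merged G u v w a b → (a ≡ v → Adj G v b) → (b ≡ v → Adj G a v) → Adj G a b
  merged-edge (_ , _ , inj₁ ab)                at-a at-b = ab
  merged-edge (_ , _ , inj₂ (inj₁ (refl , _))) at-a at-b = at-a refl
  merged-edge (_ , _ , inj₂ (inj₂ (refl , _))) at-a at-b = at-b refl

  merged-edge-transposed : Merged G u v w a b → (a ≡ v → ¬ Adj G v b) → (b ≡ v → ¬ Adj G a v) →
                           Adj G (τ a) (τ b)
  merged-edge-transposed ((_ , a≢w) , (_ , b≢w) , inj₁ ab) not-a not-b
    rewrite transpose-fix (λ a≡v → not-a a≡v (subst (λ z → Adj G z _) a≡v ab)) a≢w
          | transpose-fix (λ b≡v → not-b b≡v (subst (Adj G _) b≡v ab)) b≢w = ab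
  merged-edge-transposed (_ , (_ , b≢w) , inj₂ (inj₁ (refl , wb))) _ _
    rewrite transpose-ˡ {i = v} {w}
          | transpose-fix (λ b≡v → v≁w (Adj-sym G (subst (Adj G w) b≡v wb))) b≢w = wb
  merged-edge-transposed ((_ , a≢w) , _ , inj₂ (inj₂ (refl , aw))) _ _
    rewrite transpose-ˡ {i = v} {w}
          | transpose-fix (λ a≡v → v≁w (subst (λ z → Adj G z w) a≡v aw)) a≢w = aw

  module _ (M′ : Matching G′ k) where

    private
      merged : ∀ i → Merged G u v w (proj₁ (edge M′ i)) (proj₂ (edge M′ i))
      merged i = merge⁻ G u v w v≁w {proj₁ (edge M′ i)} {proj₂ (edge M′ i)} (adjacent M′ i)

      kept : ∀ s → Kept G u v w (end M′ s)
      kept (inj₁ i) = proj₁ (merged i)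
      kept (inj₂ i) = proj₁ (proj₂ (merged i))

      u∉M′ : Exposed M′ u
      u∉M′ (s , s↦u) = proj₁ (kept s) s↦u

      w∉M′ : Exposed M′ w
      w∉M′ (s , s↦w) = proj₂ (kept s) s↦w

    liftKeeping : (∀ s → end M′ s ≡ v → Adj G v (end M′ (swap s))) → Matching G (suc k)
    liftKeeping partner = extend M uw u∉M′ w∉M′
      where
      M : Matching G k
      M = retarget M′ λ i → merged-edge (merged i)
                                        (partner (inj₁ i)) (Adj-sym G ∘ partner (inj₂ i))

    liftSwapping : (∀ s → end M′ s ≡ v → ¬ Adj G v (end M′ (swap s))) → Matching G (suc k)
    liftSwapping partner = extend M uv
      (subst (Exposed M) (transpose-fix (Adj-irrefl G uv) (Adj-irrefl G uw)) (moved u∉M′))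
      (subst (Exposed M) (transpose-ʳ (v≢w ∘ sym)) (moved w∉M′))
      where
      adjacent′ : ∀ i → Adj G (τ (proj₁ (edge M′ i))) (τ (proj₂ (edge M′ i)))
      adjacent′ i = merged-edge-transposed (merged i)
                      (partner (inj₁ i)) (λ b≡v → partner (inj₂ i) b≡v ∘ Adj-sym G)
      M : Matching G k
      M = relabel {G = G} M′ transpose-injective adjacent′

      moved : Exposed M′ x → Exposed M (τ x)
      moved = relabel-exposed {G = G} M′ transpose-injective adjacent′

  -- If v is matched along an edge of G, M′ is already a matching of G and uw extends it;
  -- otherwise v's partner is a neighbour of w, so swapping v and w moves M′ into G and uv extends it.
  liftMatching : Matching G′ k → Matching G (suc k)
  liftMatching M′ with saturates? M′ v
  ... | no v∉M′ = liftKeeping M′ λ s s↦v → contradiction (s , s↦v) v∉M′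
  ... | yes (s₀ , s₀↦v) with adj? G v (end M′ (swap s₀))
  ...   | yes vy =
    liftKeeping M′ λ s s↦v → subst (Adj G v) (partner-unique M′ s₀ s s₀↦v s↦v) vy
  ...   | no v≁y =
    liftSwapping M′ λ s s↦v → v≁y ∘ subst (Adj G v) (partner-unique M′ s s₀ s↦v s₀↦v)

  lift : KönigPair G′ → KönigPair G
  lift (pair M′ C′ m′≤k′) = pair (liftMatching M′) (liftCover C′) (s≤s m′≤k′)

module InductionStep {side : Fin n → Bool} (G : Graph n) (bip : IsBipartition side G)
                     (rec : ∀ {H} → H ≺ G → IsBipartition side H → KönigPair H) where

  recurseProper : (H : Graph n) → H ⊆ G → ¬ Adj H a b → Adj G a b → KönigPair H
  recurseProper H H⊆G a≁b ab =
    rec (⊂-≺ {H = H} {G} H⊆G a≁b ab) (⊆-isBipartition {H = H} {G} H⊆G bip)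

  saturatedCase : Adj G u v → (M : Matching G k) → Exposed M v → Cover G m → m ≤ suc k →
                  ∀ s₀ → end M s₀ ≡ u → end M (swap s₀) ≡ w → KönigPair G
  saturatedCase {u} {v} {w = w} uv M v∉M C m≤1+k s₀ s₀↦u s₀↦w
    with any? (λ x → adj? G u x ×-dec ¬? (x ≟ v) ×-dec ¬? (x ≟ w))
  ... | yes (x , ux , x≢v , x≢w) =
    rizzi uv (x≢v ∘ sym) (retarget M λ i → deleteEdge⁺ G u x (adjacent M i) (avoids i)) v∉M
      C m≤1+k (recurseProper (deleteEdge G u x) (deleteEdge-⊆ G u x) (deleteEdge-∌ G u x) ux)
    where
    avoids : ∀ i → ¬ Joins u x (proj₁ (edge M i)) (proj₂ (edge M i))
    avoids i (inj₁ (a≡u , b≡x)) =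
      x≢w (trans (sym b≡x) (trans (partner-unique M (inj₁ i) s₀ a≡u s₀↦u) s₀↦w))
    avoids i (inj₂ (a≡x , b≡u)) =
      x≢w (trans (sym a≡x) (trans (partner-unique M (inj₂ i) s₀ b≡u s₀↦u) s₀↦w))
  ... | no ¬x =
    Contraction.lift G uv uw v≢w v≁w N[u]
      (rec (merge-≺ {G = G} v≁w uv) (merge-isBipartition {G = G} v≁w v∼w bip))
    where
    uw : Adj G u w
    uw = subst₂ (Adj G) s₀↦u s₀↦w (end-swap-adjacent M s₀)
    v≢w : v ≢ w
    v≢w v≡w = v∉M (swap s₀ , trans s₀↦w (sym v≡w))
    v∼w : side v ≡ side w
    v∼w = trans (Bool.¬-not (bip uv ∘ sym)) (sym (Bool.¬-not (bip uw ∘ sym)))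
    v≁w : ¬ Adj G v w
    v≁w vw = bip vw v∼w
    N[u] : Adj G u x → x ≡ v ⊎ x ≡ w
    N[u] {x} ux with x ≟ v | x ≟ w
    ... | yes x≡v | _       = inj₁ x≡v
    ... | no _    | yes x≡w = inj₂ x≡w
    ... | no x≢v  | no x≢w  = contradiction (x , ux , x≢v , x≢w) ¬x

  extendOrRecurse : Adj G u v → (M : Matching G k) → Exposed M v → Cover G (suc m) → m ≤ k →
                    KönigPair G
  extendOrRecurse {u} uv M v∉M C m≤k with saturates? M u
  ... | no u∉M          = pair (extend M uv u∉M v∉M) C (s≤s m≤k)
  ... | yes (s₀ , s₀↦u) = saturatedCase uv M v∉M C (s≤s m≤k) s₀ s₀↦u refl

  withEdge : Adj G u v → KönigPair (deleteVertex G v) → KönigPair G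
  withEdge {v = v} uv (pair M₁ C₁ m₁≤k₁) = extendOrRecurse uv
    (⊆-matching (deleteVertex-⊆ G v) M₁) (deleteVertex-exposed {G = G} M₁)
    (deleteVertex-cover {G = G} C₁) m₁≤k₁

  emptyPair : (∀ a b → ¬ Adj G a b) → KönigPair G
  emptyPair noEdge = pair {matchingSize = 0}
    (record { edge = λ () ; adjacent = λ () ; disjoint = λ { {inj₁ ()} ; {inj₂ ()} } })
    (record { vertex = λ () ; covers = λ {a} {b} ab → contradiction ab (noEdge a b) })
    z≤n

  königPair : KönigPair G
  königPair with any? (λ a → any? (adj? G a))
  ... | no noEdge        = emptyPair λ a b ab → noEdge (a , b , ab)
  ... | yes (u , v , uv) =
    withEdge uv (recurseProper (deleteVertex G v) (deleteVertex-⊆ G v) (deleteVertex-∌ G v) uv)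

könig : (G : Graph n) → Bipartite G → KönigPair G
könig {n} G (side , bip) = go G (≺-wellFounded G) λ {a} {b} → bip a b
  where
  go : (G : Graph n) → Acc _≺_ G → IsBipartition side G → KönigPair G
  go G (acc rs) bip = InductionStep.königPair G bip λ H≺G → go _ (rs H≺G)

-- Colouring along a vertex cover

splitAt-injective : ∀ m {n} → Injective _≡_ _≡_ (splitAt m {n})
splitAt-injective m {n} {x} {x′} p =
  trans (sym (join-splitAt m n x)) (trans (cong (join m n) p) (join-splitAt m n x′))

-- Λ t = Σⱼ (tⱼ ∸ 1), so Fin (Λ t) splits into blocks of sizes tⱼ ∸ 1; x is sent to its block
-- and its rank in that block.
slot : ∀ {q} (t : Fin q → ℕ) → Fin (Λ t) → Fin q × ℕ
slot {suc q} t x =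
  [ (λ r → zero , toℕ r) , map₁ suc ∘ slot (t ∘ suc) ]′ (splitAt (t zero ∸ 1) x)

slot-bound : ∀ {q} (t : Fin q → ℕ) x → proj₂ (slot t x) < t (proj₁ (slot t x)) ∸ 1
slot-bound {suc q} t x with splitAt (t zero ∸ 1) x
... | inj₁ r = toℕ<n r
... | inj₂ y = slot-bound (t ∘ suc) y

slot-injective : ∀ {q} (t : Fin q → ℕ) → Injective _≡_ _≡_ (slot t)
slot-injective {suc q} t {x} {x′} eq
  with splitAt (t zero ∸ 1) x in p | splitAt (t zero ∸ 1) x′ in p′
... | inj₁ r | inj₁ r′ = splitAt-injective (t zero ∸ 1)
  (trans p (trans (cong inj₁ (toℕ-injective (cong proj₂ eq))) (sym p′)))
... | inj₁ _ | inj₂ _  = contradiction (cong proj₁ eq) λ ()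
... | inj₂ _ | inj₁ _  = contradiction (cong proj₁ eq) λ ()
... | inj₂ y | inj₂ y′ = splitAt-injective (t zero ∸ 1) (trans p (trans (cong inj₂ y≡y′) (sym p′)))
  where
  y≡y′ : y ≡ y′
  y≡y′ = slot-injective (t ∘ suc) (cong₂ _,_ (suc-injective (cong proj₁ eq)) (cong proj₂ eq))

injective-bounded⇒≤ : {f : Fin k → ℕ} → Injective _≡_ _≡_ f → (∀ i → f i < m) → k ≤ m
injective-bounded⇒≤ {f = f} f-inj f<m = injective⇒≤ {f = λ i → fromℕ< (f<m i)} λ {i} {j} p →
  f-inj (trans (sym (toℕ-fromℕ< (f<m i))) (trans (cong toℕ p) (toℕ-fromℕ< (f<m j))))

-- Taking the first cover vertex on an edge makes the colour symmetric in its endpoints.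
module CoverColouring {G : Graph n} {q} (C : Cover G m) (t : Fin (suc q) → ℕ) (m≤Λ : m ≤ Λ t) where

  group : Fin m → Fin (suc q) × ℕ
  group κ = slot t (inject≤ κ m≤Λ)

  incident? : ∀ a b κ → Dec (Incident (vertex C κ) a b)
  incident? a b κ = (vertex C κ ≟ a) ⊎-dec (vertex C κ ≟ b)

  colourOf : List (Fin m) → Fin (suc q)
  colourOf []      = zero
  colourOf (κ ∷ _) = proj₁ (group κ)

  colouring : Colouring G (suc q)
  colouring = record
    { colour     = λ a b → colourOf (filter (incident? a b) (allFin m))
    ; colour-sym = λ a b →
        cong colourOf (filter-≐ (incident? a b) (incident? b a) (swap , swap) (allFin m))
    }

  chosen : Adj G a b → ∃ λ κ → colour colouring a b ≡ proj₁ (group κ) × Incident (vertex C κ) a b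
  chosen {a} {b} ab with filter (incident? a b) (allFin m) in eq | covers C ab
  ... | []    | κ , incident =
    contradiction (subst (κ ∈_) eq (∈-filter⁺ (incident? a b) (∈-allFin κ) incident)) λ ()
  ... | κ ∷ _ | _ =
    κ , refl , proj₂ (∈-filter⁻ (incident? a b) {xs = allFin m} (subst (κ ∈_) (sym eq) (here refl)))

  noMonochromaticMatching : ∀ j → MonoMatching G colouring j (t j) → t j ≤ t j ∸ 1
  noMonochromaticMatching j (M , mono) = injective-bounded⇒≤ rank-injective rank<
    where
    κ : Fin (t j) → Fin m
    κ i = proj₁ (chosen (adjacent M i))

    group≡j : ∀ i → proj₁ (group (κ i)) ≡ j
    group≡j i = trans (sym (proj₁ (proj₂ (chosen (adjacent M i))))) (mono i)

    rank : Fin (t j) → ℕ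
    rank i = proj₂ (group (κ i))

    rank< : ∀ i → rank i < t j ∸ 1
    rank< i = subst (λ j′ → rank i < t j′ ∸ 1) (group≡j i) (slot-bound t (inject≤ (κ i) m≤Λ))

    rank-injective : Injective _≡_ _≡_ rank
    rank-injective {i} {i′} p =
      coverChoice-injective M {c = vertex C} (λ i → κ i , proj₂ (proj₂ (chosen (adjacent M i))))
        (inject≤-injective m≤Λ m≤Λ _ _
          (slot-injective t (cong₂ _,_ (trans (group≡j i) (sym (group≡j i′))) p)))

open CoverColouring using (colouring; noMonochromaticMatching)

proposition4p2 : ∀ (n : ℕ) (G : Graph n) → Bipartite G →
    ∀ (q : ℕ) → 1 ≤ q → ¬ WeaklyCL q G
proposition4p2 n G bipartite (suc q) _ (t , t≥1 , (ν , (_ , ν-max) , ν≤Λ) , arrows)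
  with pair M C m≤k ← könig G bipartite
  with j , mono ← arrows (colouring C t (≤-trans m≤k (≤-trans (ν-max _ M) ν≤Λ)))
  = <⇒≱ (∸-monoʳ-< z<s (t≥1 j)) (noMonochromaticMatching C t _ j mono)
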